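{- Let $G$ be a context-free grammar with ownership, $A$ a nondeterministic finite automaton over its terminals, $\sigma$ the least solution of the induced system of equations, and $W_\square=\{\alpha:\sigma(\alpha)\text{ is not rejecting}\}$. The prover strategy that, at a prover-owned position, applies a rule such that $\sigma$ of the resulting position is not rejecting (if such a rule exists) is a winning strategy for prover in the inclusion game from every position in $W_\square$.
   Context: Game: $G=(N_{\bigcirc}\,\dot\cup\,N_{\square},T,P)$ with disjoint finite sets of non-terminals $N=N_\bigcirc\cup N_\square$ and terminals $T$, finitely many rules $X\to\eta$ ($X\in N$, $\eta\in(N\cup T)^*$), every non-terminal having a rule. $N_\bigcirc$ is owned by refuter, $N_\square$ by prover. Left derivation: $wX\gamma\Rightarrow_L w\eta\gamma$ for $w\in T^*$, $X\in N$, a rule $X\to\eta$. A sentential form is owned by prover if its leftmost non-terminal is in $N_\square$, else by refuter. Plays are finite or infinite $\Rightarrow_L$-paths, maximal if infinite or ending in a terminal word. $A=(T,Q,q_0,Q_F,\to)$ has language $L(A)$. The inclusion condition (prover's goal) holds for a maximal play if it is infinite or ends in a word of $L(A)$. A strategy for prover maps non-maximal finite plays ending in a prover position to a successor; it is winning from $p_0$ if every maximal play from $p_0$ conforming to it satisfies the inclusion condition. Domain: Boxes are subsets of $Q\times Q$ with relational composition $\rho;\tau=\{(q,q''):\exists q'.(q,q')\in\rho,(q',q'')\in\tau\}$, $\mathrm{id}=\{(q,q)\}$, $[a]=\{(q,q'):q\xrightarrow{a}q'\}$. Formulas are negation-free Boolean formulas over boxes with constant $\mathit{false}$ ($\mathit{false}\wedge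 F=\mathit{false}$, $\mathit{false}\vee F=F$, symmetric, applied syntactically), composed by $F;\mathit{false}=\mathit{false};G=\mathit{false}$, $(F_1\star F_2);G=(F_1;G)\star(F_2;G)$, $\rho;(G_1\star G_2)=(\rho;G_1)\star(\rho;G_2)$, $\star\in\{\wedge,\vee\}$; taken modulo logical equivalence and ordered by implication. The induced system: for each $X$ with rules $X\to\eta_1,\dots,X\to\eta_k$, $\Delta_X=\bigwedge_j[\eta_j]$ if $X\in N_\square$, $\Delta_X=\bigvee_j[\eta_j]$ if $X\in N_\bigcirc$, with $[\varepsilon]=\mathrm{id}$, $[a]$ the box of $a$, $[Y]=\Delta_Y$, $[\alpha\beta]=[\alpha];[\beta]$. $\sigma$ is its least solution (Kleene iteration from $\mathit{false}$), extended by $\sigma(\varepsilon)=\mathrm{id}$, $\sigma(a)=[a]$, $\sigma(\alpha\beta)=\sigma(\alpha);\sigma(\beta)$. A formula is rejecting if it is true under the assignment mapping a box $\rho$ to true iff $\rho$ contains no pair $(q_0,q_f)$ with $q_f\in Q_F$. -}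

module Defs where

open import Data.Nat using (ℕ; zero; suc)
open import Data.Fin using (Fin; _≟_)
import Data.Fin as F
open import Data.Bool using (Bool; true; false; _∧_; _∨_; not)
open import Data.List using (List; []; _∷_; _++_; map)
open import Data.List.Membership.Propositional using (_∈_)
open import Data.Vec using (Vec; lookup; tabulate)
open import Data.Sum using (_⊎_; inj₁; inj₂)
open import Data.Product using (Σ; ∃; _×_; _,_)
open import Relation.Nullary using (¬_; does)
open import Relation.Binary.PropositionalEquality using (_≡_)

Sym : ℕ → ℕ → Set
Sym n t = Fin n ⊎ Fin t          -- inj₁ = non-terminal, inj₂ = terminal

-- sentential forms (positions of the game)
SF : ℕ → ℕ → Set
SF n t = List (Sym n t)

word : ∀ {n t} → List (Fin t) → SF n t
word = map inj₂

data Owner : Set where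
  prover refuter : Owner          -- prover owns N_□, refuter owns N_○

record Grammar (n t : ℕ) : Set where
  field
    owner   : Fin n → Owner
    rules   : Fin n → List (SF n t)     -- right-hand sides η of the rules X → η
    hasRule : ∀ X → ¬ (rules X ≡ [])

record NFA (k t : ℕ) : Set where
  field
    δ     : Fin k → Fin t → Fin k → Bool
    q₀    : Fin k
    final : Fin k → Bool

data Run {k t} (A : NFA k t) : Fin k → List (Fin t) → Fin k → Set where
  nil  : ∀ {q} → Run A q [] q
  cons : ∀ {q a q' w q''} → NFA.δ A q a q' ≡ true → Run A q' w q'' → Run A q (a ∷ w) q''

InL : ∀ {k t} → NFA k t → List (Fin t) → Set
InL A w = ∃ λ qf → Run A (NFA.q₀ A) w qf × NFA.final A qf ≡ true

-- Boxes: subsets of Q × Q (as Boolean matrices; canonical representation)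

Box : ℕ → Set
Box k = Vec (Vec Bool k) k

_∋₂_ : ∀ {k} → Box k → Fin k × Fin k → Bool
ρ ∋₂ (q , q') = lookup (lookup ρ q) q'

anyFin : ∀ {k} → (Fin k → Bool) → Bool
anyFin {zero}  f = false
anyFin {suc k} f = f F.zero ∨ anyFin (λ i → f (F.suc i))

idBox : ∀ {k} → Box k
idBox = tabulate λ q → tabulate λ q' → does (q ≟ q')

_⨾ᵇ_ : ∀ {k} → Box k → Box k → Box k
ρ ⨾ᵇ τ = tabulate λ q → tabulate λ q'' → anyFin λ q' → (ρ ∋₂ (q , q')) ∧ (τ ∋₂ (q' , q''))

termBox : ∀ {k t} → NFA k t → Fin t → Box k
termBox A a = tabulate λ q → tabulate λ q' → NFA.δ A q a q'

data Form (k : ℕ) : Set where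
  ff   : Form k
  atom : Box k → Form k
  _∧ᶠ_ : Form k → Form k → Form k
  _∨ᶠ_ : Form k → Form k → Form k

eval : ∀ {k} → (Box k → Bool) → Form k → Bool
eval v ff        = false
eval v (atom ρ)  = v ρ
eval v (F ∧ᶠ G)  = eval v F ∧ eval v G
eval v (F ∨ᶠ G)  = eval v F ∨ eval v G

-- implication order and logical equivalence (formulas are taken modulo ≈ᶠ)
_⇛_ : ∀ {k} → Form k → Form k → Set
F ⇛ G = ∀ v → eval v F ≡ true → eval v G ≡ true

_≈ᶠ_ : ∀ {k} → Form k → Form k → Set
F ≈ᶠ G = (F ⇛ G) × (G ⇛ F)

_▹_ : ∀ {k} → Box k → Form k → Form k
ρ ▹ ff       = ff
ρ ▹ atom τ   = atom (ρ ⨾ᵇ τ)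
ρ ▹ (G ∧ᶠ H) = (ρ ▹ G) ∧ᶠ (ρ ▹ H)
ρ ▹ (G ∨ᶠ H) = (ρ ▹ G) ∨ᶠ (ρ ▹ H)

_⨾_ : ∀ {k} → Form k → Form k → Form k
ff       ⨾ G = ff
atom ρ   ⨾ G = ρ ▹ G
(F ∧ᶠ H) ⨾ G = (F ⨾ G) ∧ᶠ (H ⨾ G)
(F ∨ᶠ H) ⨾ G = (F ⨾ G) ∨ᶠ (H ⨾ G)

-- nonempty conjunction / disjunction of a list (the [] case never arises,
-- since every non-terminal has a rule)
⋀ : ∀ {k} → List (Form k) → Form k
⋀ []           = ff
⋀ (F ∷ [])     = F
⋀ (F ∷ G ∷ Fs) = F ∧ᶠ ⋀ (G ∷ Fs)

⋁ : ∀ {k} → List (Form k) → Form k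
⋁ []       = ff
⋁ (F ∷ Fs) = F ∨ᶠ ⋁ Fs

module System {n t k : ℕ} (G : Grammar n t) (A : NFA k t) where
  open Grammar G

  ⟦_⟧ : (Fin n → Form k) → SF n t → Form k
  ⟦ s ⟧ []           = atom idBox
  ⟦ s ⟧ (inj₁ Y ∷ α) = s Y ⨾ ⟦ s ⟧ α
  ⟦ s ⟧ (inj₂ a ∷ α) = atom (termBox A a) ⨾ ⟦ s ⟧ α

  Δ : (Fin n → Form k) → Fin n → Form k
  Δ s X with owner X
  ... | prover  = ⋀ (map (⟦ s ⟧) (rules X))
  ... | refuter = ⋁ (map (⟦ s ⟧) (rules X))

  IsSolution : (Fin n → Form k) → Set
  IsSolution s = ∀ X → s X ≈ᶠ Δ s X

  IsLeastSolution : (Fin n → Form k) → Set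
  IsLeastSolution σ = IsSolution σ × (∀ s → IsSolution s → ∀ X → σ X ⇛ s X)

  rejAssign : Box k → Bool
  rejAssign ρ = not (anyFin λ qf → (ρ ∋₂ (NFA.q₀ A , qf)) ∧ NFA.final A qf)

  Rejecting : Form k → Set
  Rejecting F = eval rejAssign F ≡ true

  InW : (Fin n → Form k) → SF n t → Set
  InW σ α = ¬ Rejecting (⟦ σ ⟧ α)

  -- a positional prover strategy: the right-hand side chosen at a position
  Strategy : Set
  Strategy = SF n t → SF n t

  IsσStrategy : (Fin n → Form k) → Strategy → Set
  IsσStrategy σ str =
    ∀ (w : List (Fin t)) (X : Fin n) (γ : SF n t) → owner X ≡ prover →
      let α = word w ++ inj₁ X ∷ γ in
      (str α ∈ rules X) ×
      ((∃ λ η → η ∈ rules X × InW σ (word w ++ η ++ γ)) →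
        InW σ (word w ++ str α ++ γ))

  data CStep (str : Strategy) : SF n t → SF n t → Set where
    step : ∀ (w : List (Fin t)) (X : Fin n) (γ η : SF n t) →
           η ∈ rules X →
           (owner X ≡ prover → η ≡ str (word w ++ inj₁ X ∷ γ)) →
           CStep str (word w ++ inj₁ X ∷ γ) (word w ++ η ++ γ)

  data Play (str : Strategy) (α : SF n t) : SF n t → Set where
    start : Play str α α
    extend : ∀ {β β'} → Play str α β → CStep str β β' → Play str α β'

  -- winning from α: every maximal conforming play satisfies the inclusion
  -- condition.  Infinite plays satisfy it trivially; finite maximal plays
  -- are exactly those ending in a terminal word.
  Winning : Strategy → SF n t → Set
  Winning str α = ∀ (w : List (Fin t)) → Play str α (word w) → InL A w

-- W_□ is invariant along every play conforming to the strategy.  By compositionality,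
-- σ(wXγ) and σ(wηγ) are rejecting exactly when σ(X) and σ(η) are true under one and the
-- same valuation of boxes.  Since σ solves the system, σ(X) is the disjunction (refuter)
-- or conjunction (prover) of the σ(η) over the rules X → η: at a refuter position no
-- rule leads out of W_□, and at a prover position some rule stays in W_□, so the strategy
-- picks one that does.  A terminal word w in W_□ has a box containing a pair (q₀, q_f)
-- with q_f final, i.e. an accepting run on w.
module Submission where

open import Defs
open import Data.Nat using (ℕ; suc)
open import Data.Fin using (Fin; zero; suc; _≟_)
open import Data.Bool using (Bool; true; false; _∧_; _∨_)
open import Data.Bool.Properties using (∨-zeroʳ; ⇔→≡; ¬-not; not-injective)
import Data.Bool.Properties as Bool
open import Data.List using (List; []; _∷_; _++_; map)
open import Data.List.Membership.Propositional using (_∈_; lose; find)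
open import Data.List.Relation.Unary.All using (All; []; _∷_)
open import Data.List.Relation.Unary.All.Properties using (¬All⇒Any¬)
open import Data.List.Relation.Unary.Any using (Any; here; there)
import Data.List.Relation.Unary.Any.Properties as Any
open import Data.Vec using (lookup; tabulate)
open import Data.Vec.Properties using (lookup∘tabulate; tabulate∘lookup; tabulate-cong)
open import Data.Sum using (inj₁; inj₂)
open import Data.Product using (∃; _×_; _,_; proj₁; proj₂)
open import Function using (_∘_; _∘′_)
open import Function.Bundles using (_⇔_; mk⇔; Equivalence)
open import Relation.Nullary using (¬_; does; yes; no; contradiction)
open import Relation.Binary.PropositionalEquality

open Equivalence using (to; from)

anyFin⇒∃ : ∀ {k} (f : Fin k → Bool) → anyFin f ≡ true → ∃ λ i → f i ≡ true
anyFin⇒∃ {suc k} f e with f zero in f0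
... | true  = zero , f0
... | false = let i , fi = anyFin⇒∃ (f ∘ suc) e in suc i , fi

∃⇒anyFin : ∀ {k} (f : Fin k → Bool) → (∃ λ i → f i ≡ true) → anyFin f ≡ true
∃⇒anyFin f (zero , f0) rewrite f0 = refl
∃⇒anyFin f (suc i , fi) = trans (cong (f zero ∨_) (∃⇒anyFin (f ∘ suc) (i , fi))) (∨-zeroʳ (f zero))

∧≡true⇔ : ∀ {x y} → x ∧ y ≡ true ⇔ (x ≡ true × y ≡ true)
∧≡true⇔ {true}  {true}  = mk⇔ (λ _ → refl , refl) (λ _ → refl)
∧≡true⇔ {true}  {false} = mk⇔ (λ ()) proj₂
∧≡true⇔ {false} {_}     = mk⇔ (λ ()) proj₁

module _ {k : ℕ} where

  ∋₂-tabulate : (f : Fin k → Fin k → Bool) (q q' : Fin k) →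
                tabulate (λ q → tabulate (f q)) ∋₂ (q , q') ≡ f q q'
  ∋₂-tabulate f q q' = trans (cong (λ r → lookup r q') (lookup∘tabulate _ q)) (lookup∘tabulate _ q')

  box-ext : (ρ τ : Box k) → (∀ q q' → ρ ∋₂ (q , q') ≡ τ ∋₂ (q , q')) → ρ ≡ τ
  box-ext ρ τ e = begin
    ρ                   ≡⟨ sym (tabulate∘lookup ρ) ⟩
    tabulate (lookup ρ) ≡⟨ tabulate-cong row ⟩
    tabulate (lookup τ) ≡⟨ tabulate∘lookup τ ⟩
    τ                   ∎
    where
    open ≡-Reasoning
    row : ∀ q → lookup ρ q ≡ lookup τ q
    row q = trans (sym (tabulate∘lookup (lookup ρ q)))
                  (trans (tabulate-cong (e q)) (tabulate∘lookup (lookup τ q)))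

  box-ext-⇔ : (ρ τ : Box k) → (∀ q q' → ρ ∋₂ (q , q') ≡ true ⇔ τ ∋₂ (q , q') ≡ true) → ρ ≡ τ
  box-ext-⇔ ρ τ e = box-ext ρ τ λ q q' → ⇔→≡ (e q q')

  idBox-∋₂⇔ : {q q' : Fin k} → idBox ∋₂ (q , q') ≡ true ⇔ q ≡ q'
  idBox-∋₂⇔ {q} {q'} rewrite ∋₂-tabulate (λ q q' → does (q ≟ q')) q q'
    with q ≟ q'
  ... | yes q≡q' = mk⇔ (λ _ → q≡q') (λ _ → refl)
  ... | no  q≢q' = mk⇔ (λ ()) (λ q≡q' → contradiction q≡q' q≢q')

  ⨾ᵇ-∋₂⇔ : (ρ τ : Box k) {q q'' : Fin k} →
           (ρ ⨾ᵇ τ) ∋₂ (q , q'') ≡ true ⇔ ∃ λ q' → ρ ∋₂ (q , q') ≡ true × τ ∋₂ (q' , q'') ≡ true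
  ⨾ᵇ-∋₂⇔ ρ τ {q} {q''}
    rewrite ∋₂-tabulate (λ q q'' → anyFin λ q' → (ρ ∋₂ (q , q')) ∧ (τ ∋₂ (q' , q''))) q q'' =
    mk⇔ (λ e → let q' , p = anyFin⇒∃ _ e in q' , to ∧≡true⇔ p)
        (λ (q' , p) → ∃⇒anyFin _ (q' , from ∧≡true⇔ p))

  ⨾ᵇ-identityˡ : (τ : Box k) → idBox ⨾ᵇ τ ≡ τ
  ⨾ᵇ-identityˡ τ = box-ext-⇔ _ τ λ q q' → mk⇔
    (λ e → let _ , q≡a , τaq' = to (⨾ᵇ-∋₂⇔ idBox τ) e
           in subst (λ a → τ ∋₂ (a , q') ≡ true) (sym (to idBox-∋₂⇔ q≡a)) τaq')
    (λ τqq' → from (⨾ᵇ-∋₂⇔ idBox τ) (q , from idBox-∋₂⇔ refl , τqq'))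

  ⨾ᵇ-identityʳ : (ρ : Box k) → ρ ⨾ᵇ idBox ≡ ρ
  ⨾ᵇ-identityʳ ρ = box-ext-⇔ _ ρ λ q q' → mk⇔
    (λ e → let _ , ρqa , a≡q' = to (⨾ᵇ-∋₂⇔ ρ idBox) e
           in subst (λ a → ρ ∋₂ (q , a) ≡ true) (to idBox-∋₂⇔ a≡q') ρqa)
    (λ ρqq' → from (⨾ᵇ-∋₂⇔ ρ idBox) (q' , ρqq' , from idBox-∋₂⇔ refl))

  ⨾ᵇ-assoc : (ρ τ μ : Box k) → (ρ ⨾ᵇ τ) ⨾ᵇ μ ≡ ρ ⨾ᵇ (τ ⨾ᵇ μ)
  ⨾ᵇ-assoc ρ τ μ = box-ext-⇔ _ _ λ q r → mk⇔
    (λ e → let b , ρτqb , μbr = to (⨾ᵇ-∋₂⇔ (ρ ⨾ᵇ τ) μ) e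
               a , ρqa , τab  = to (⨾ᵇ-∋₂⇔ ρ τ) ρτqb
           in from (⨾ᵇ-∋₂⇔ ρ (τ ⨾ᵇ μ)) (a , ρqa , from (⨾ᵇ-∋₂⇔ τ μ) (b , τab , μbr)))
    (λ e → let a , ρqa , τμar = to (⨾ᵇ-∋₂⇔ ρ (τ ⨾ᵇ μ)) e
               b , τab , μbr  = to (⨾ᵇ-∋₂⇔ τ μ) τμar
           in from (⨾ᵇ-∋₂⇔ (ρ ⨾ᵇ τ) μ) (b , from (⨾ᵇ-∋₂⇔ ρ τ) (a , ρqa , τab) , μbr))

module _ {k : ℕ} where

  infix 4 _⊨_ _≋_
  infixl 5 _⊳_

  _⊨_ : (Box k → Bool) → Form k → Set
  v ⊨ F = eval v F ≡ true

  _≋_ : Form k → Form k → Set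
  F ≋ G = ∀ v → eval v F ≡ eval v G

  _⊳_ : (Box k → Bool) → Form k → Box k → Bool
  (v ⊳ G) ρ = eval (v ∘′ (ρ ⨾ᵇ_)) G

  eval-cong : {v v' : Box k → Bool} → (∀ ρ → v ρ ≡ v' ρ) → ∀ F → eval v F ≡ eval v' F
  eval-cong e ff       = refl
  eval-cong e (atom ρ) = e ρ
  eval-cong e (F ∧ᶠ G) = cong₂ _∧_ (eval-cong e F) (eval-cong e G)
  eval-cong e (F ∨ᶠ G) = cong₂ _∨_ (eval-cong e F) (eval-cong e G)

  eval-▹ : ∀ (v : Box k → Bool) ρ G → eval v (ρ ▹ G) ≡ eval (v ∘′ (ρ ⨾ᵇ_)) G
  eval-▹ v ρ ff       = refl
  eval-▹ v ρ (atom τ) = refl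
  eval-▹ v ρ (G ∧ᶠ H) = cong₂ _∧_ (eval-▹ v ρ G) (eval-▹ v ρ H)
  eval-▹ v ρ (G ∨ᶠ H) = cong₂ _∨_ (eval-▹ v ρ G) (eval-▹ v ρ H)

  eval-⨾ : ∀ (v : Box k → Bool) F G → eval v (F ⨾ G) ≡ eval (v ⊳ G) F
  eval-⨾ v ff       G = refl
  eval-⨾ v (atom ρ) G = eval-▹ v ρ G
  eval-⨾ v (F ∧ᶠ H) G = cong₂ _∧_ (eval-⨾ v F G) (eval-⨾ v H G)
  eval-⨾ v (F ∨ᶠ H) G = cong₂ _∨_ (eval-⨾ v F G) (eval-⨾ v H G)

  ⨾-congʳ : ∀ F {G G'} → G ≋ G' → F ⨾ G ≋ F ⨾ G'
  ⨾-congʳ F {G} {G'} G≋G' v = begin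
    eval v (F ⨾ G)  ≡⟨ eval-⨾ v F G ⟩
    eval (v ⊳ G) F  ≡⟨ eval-cong (λ ρ → G≋G' (v ∘′ (ρ ⨾ᵇ_))) F ⟩
    eval (v ⊳ G') F ≡⟨ eval-⨾ v F G' ⟨
    eval v (F ⨾ G') ∎
    where open ≡-Reasoning

  ⨾-assoc : ∀ F G H → (F ⨾ G) ⨾ H ≋ F ⨾ (G ⨾ H)
  ⨾-assoc F G H v = begin
    eval v ((F ⨾ G) ⨾ H) ≡⟨ eval-⨾ v (F ⨾ G) H ⟩
    eval (v ⊳ H) (F ⨾ G) ≡⟨ eval-⨾ (v ⊳ H) F G ⟩
    eval (v ⊳ H ⊳ G) F   ≡⟨ eval-cong shift F ⟩
    eval (v ⊳ (G ⨾ H)) F ≡⟨ eval-⨾ v F (G ⨾ H) ⟨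
    eval v (F ⨾ (G ⨾ H)) ∎
    where
    open ≡-Reasoning
    shift : ∀ ρ → (v ⊳ H ⊳ G) ρ ≡ (v ⊳ (G ⨾ H)) ρ
    shift ρ = trans (eval-cong (λ τ → eval-cong (λ τ' → cong v (⨾ᵇ-assoc ρ τ τ')) H) G)
                    (sym (eval-⨾ (v ∘′ (ρ ⨾ᵇ_)) G H))

  ⨾-identityˡ : ∀ G → atom idBox ⨾ G ≋ G
  ⨾-identityˡ G v = trans (eval-▹ v idBox G) (eval-cong (λ τ → cong v (⨾ᵇ-identityˡ τ)) G)

  ⨾-identityʳ : ∀ F → F ⨾ atom idBox ≋ F
  ⨾-identityʳ F v = trans (eval-⨾ v F (atom idBox)) (eval-cong (λ ρ → cong v (⨾ᵇ-identityʳ ρ)) F)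

  ⊨⋀ : ∀ {v F Fs} → All (v ⊨_) (F ∷ Fs) → v ⊨ ⋀ (F ∷ Fs)
  ⊨⋀ (vF ∷ [])       = vF
  ⊨⋀ (vF ∷ vG ∷ vFs) rewrite vF = ⊨⋀ (vG ∷ vFs)

  ⊨⋁ : ∀ {v Fs} → Any (v ⊨_) Fs → v ⊨ ⋁ Fs
  ⊨⋁ (here vF) rewrite vF = refl
  ⊨⋁ {v} {F ∷ _} (there vFs) = trans (cong (eval v F ∨_) (⊨⋁ vFs)) (∨-zeroʳ (eval v F))

  ¬⊨⋀-map : ∀ {A : Set} {v} (f : A → Form k) (xs : List A) → ¬ xs ≡ [] →
            ¬ v ⊨ ⋀ (map f xs) → ∃ λ x → x ∈ xs × ¬ v ⊨ f x
  ¬⊨⋀-map f []       xs≢[] _   = contradiction refl xs≢[]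
  ¬⊨⋀-map {v = v} f (_ ∷ _) _ ¬v⊨ =
    find (Any.map⁻ (¬All⇒Any¬ (λ F → eval v F Bool.≟ true) _ (¬v⊨ ∘ ⊨⋀)))

  ⊨⋁-map : ∀ {A : Set} {v} (f : A → Form k) {x xs} → x ∈ xs → v ⊨ f x → v ⊨ ⋁ (map f xs)
  ⊨⋁-map f x∈xs v⊨fx = ⊨⋁ (Any.map⁺ (lose x∈xs v⊨fx))

wordBox : ∀ {k t} → NFA k t → List (Fin t) → Box k
wordBox A []      = idBox
wordBox A (a ∷ w) = termBox A a ⨾ᵇ wordBox A w

wordBox⇒Run : ∀ {k t} (A : NFA k t) w {q q'} → wordBox A w ∋₂ (q , q') ≡ true → Run A q w q'
wordBox⇒Run A []      {q} {q'} e with refl ← to (idBox-∋₂⇔ {q = q} {q'}) e = nil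
wordBox⇒Run A (a ∷ w) e =
  let p , δqap , wpq' = to (⨾ᵇ-∋₂⇔ (termBox A a) (wordBox A w)) e
  in cons (trans (sym (∋₂-tabulate _ _ p)) δqap) (wordBox⇒Run A w wpq')

module SententialForms {n t k : ℕ} (G : Grammar n t) (A : NFA k t) (s : Fin n → Form k) where
  open System G A

  ⟦++⟧ : ∀ α β → ⟦ s ⟧ (α ++ β) ≋ ⟦ s ⟧ α ⨾ ⟦ s ⟧ β
  ⨾-⟦++⟧ : ∀ F α β → F ⨾ ⟦ s ⟧ (α ++ β) ≋ (F ⨾ ⟦ s ⟧ α) ⨾ ⟦ s ⟧ β

  ⟦++⟧ []           β v = sym (⨾-identityˡ (⟦ s ⟧ β) v)
  ⟦++⟧ (inj₁ Y ∷ α) β   = ⨾-⟦++⟧ (s Y) α β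
  ⟦++⟧ (inj₂ a ∷ α) β   = ⨾-⟦++⟧ (atom (termBox A a)) α β

  ⨾-⟦++⟧ F α β v = trans (⨾-congʳ F (⟦++⟧ α β) v) (sym (⨾-assoc F (⟦ s ⟧ α) (⟦ s ⟧ β) v))

  ⟦word⟧ : ∀ w → ⟦ s ⟧ (word w) ≡ atom (wordBox A w)
  ⟦word⟧ []      = refl
  ⟦word⟧ (a ∷ w) = cong (termBox A a ▹_) (⟦word⟧ w)

  hole : List (Fin t) → SF n t → (Box k → Bool) → Box k → Bool
  hole w γ v = (v ⊳ ⟦ s ⟧ γ) ∘′ (wordBox A w ⨾ᵇ_)

  ⟦plug⟧ : ∀ w η γ v → eval v (⟦ s ⟧ (word w ++ η ++ γ)) ≡ eval (hole w γ v) (⟦ s ⟧ η)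
  ⟦plug⟧ w η γ v = begin
    eval v (⟦ s ⟧ (word w ++ η ++ γ))             ≡⟨ ⟦++⟧ (word w) (η ++ γ) v ⟩
    eval v (⟦ s ⟧ (word w) ⨾ ⟦ s ⟧ (η ++ γ))      ≡⟨ ⨾-congʳ (⟦ s ⟧ (word w)) (⟦++⟧ η γ) v ⟩
    eval v (⟦ s ⟧ (word w) ⨾ (⟦ s ⟧ η ⨾ ⟦ s ⟧ γ)) ≡⟨ ⨾-assoc (⟦ s ⟧ (word w)) (⟦ s ⟧ η) (⟦ s ⟧ γ) v ⟨
    eval v ((⟦ s ⟧ (word w) ⨾ ⟦ s ⟧ η) ⨾ ⟦ s ⟧ γ) ≡⟨ eval-⨾ v (⟦ s ⟧ (word w) ⨾ ⟦ s ⟧ η) (⟦ s ⟧ γ) ⟩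
    eval (v ⊳ ⟦ s ⟧ γ) (⟦ s ⟧ (word w) ⨾ ⟦ s ⟧ η) ≡⟨ cong (λ F → eval (v ⊳ ⟦ s ⟧ γ) (F ⨾ ⟦ s ⟧ η)) (⟦word⟧ w) ⟩
    eval (v ⊳ ⟦ s ⟧ γ) (wordBox A w ▹ ⟦ s ⟧ η)    ≡⟨ eval-▹ (v ⊳ ⟦ s ⟧ γ) (wordBox A w) (⟦ s ⟧ η) ⟩
    eval (hole w γ v) (⟦ s ⟧ η)                   ∎
    where open ≡-Reasoning

  ⟦plug-nonterminal⟧ : ∀ w X γ v → eval v (⟦ s ⟧ (word w ++ inj₁ X ∷ γ)) ≡ eval (hole w γ v) (s X)
  ⟦plug-nonterminal⟧ w X γ v = trans (⟦plug⟧ w (inj₁ X ∷ []) γ v) (⨾-identityʳ (s X) (hole w γ v))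

module Invariant {n t k : ℕ} (G : Grammar n t) (A : NFA k t) (σ : Fin n → Form k)
                 (isSolution : System.IsSolution G A σ) where
  open Grammar G
  open System G A
  open SententialForms G A σ

  Δ-prover : ∀ X → owner X ≡ prover → Δ σ X ≡ ⋀ (map ⟦ σ ⟧ (rules X))
  Δ-prover X owner≡ rewrite owner≡ = refl

  Δ-refuter : ∀ X → owner X ≡ refuter → Δ σ X ≡ ⋁ (map ⟦ σ ⟧ (rules X))
  Δ-refuter X owner≡ rewrite owner≡ = refl

  InW⇒¬⊨Δ : ∀ w X γ → InW σ (word w ++ inj₁ X ∷ γ) → ¬ hole w γ rejAssign ⊨ Δ σ X
  InW⇒¬⊨Δ w X γ inW ⊨Δ = inW (trans (⟦plug-nonterminal⟧ w X γ rejAssign) (proj₂ (isSolution X) _ ⊨Δ))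

  ¬⊨⇒InW : ∀ w η γ → ¬ hole w γ rejAssign ⊨ ⟦ σ ⟧ η → InW σ (word w ++ η ++ γ)
  ¬⊨⇒InW w η γ ¬⊨ rejecting = ¬⊨ (trans (sym (⟦plug⟧ w η γ rejAssign)) rejecting)

  refuter-move-InW : ∀ w X γ {η} → owner X ≡ refuter → η ∈ rules X →
                     InW σ (word w ++ inj₁ X ∷ γ) → InW σ (word w ++ η ++ γ)
  refuter-move-InW w X γ {η} owner≡ η∈ inW = ¬⊨⇒InW w η γ λ ⊨η →
    InW⇒¬⊨Δ w X γ inW (subst (hole w γ rejAssign ⊨_) (sym (Δ-refuter X owner≡)) (⊨⋁-map ⟦ σ ⟧ η∈ ⊨η))

  prover-move-InW : ∀ w X γ → owner X ≡ prover → InW σ (word w ++ inj₁ X ∷ γ) →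
                    ∃ λ η → η ∈ rules X × InW σ (word w ++ η ++ γ)
  prover-move-InW w X γ owner≡ inW =
    let η , η∈ , ¬⊨η = ¬⊨⋀-map ⟦ σ ⟧ (rules X) (hasRule X) λ ⊨⋀ →
                         InW⇒¬⊨Δ w X γ inW (subst (hole w γ rejAssign ⊨_) (sym (Δ-prover X owner≡)) ⊨⋀)
    in η , η∈ , ¬⊨⇒InW w η γ ¬⊨η

  module _ (str : Strategy) (σstr : IsσStrategy σ str) where

    step-InW : ∀ {β β'} → CStep str β β' → InW σ β → InW σ β'
    step-InW (step w X γ η η∈ chosen) inW with owner X in owner≡
    ... | refuter = refuter-move-InW w X γ owner≡ η∈ inW
    ... | prover rewrite chosen refl = proj₂ (σstr w X γ owner≡) (prover-move-InW w X γ owner≡ inW)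

    play-InW : ∀ {α β} → Play str α β → InW σ α → InW σ β
    play-InW start            inW = inW
    play-InW (extend play st) inW = step-InW st (play-InW play inW)

  InW-word⇒InL : ∀ w → InW σ (word w) → InL A w
  InW-word⇒InL w inW =
    let qf , accepting = anyFin⇒∃ _ (not-injective (¬-not (inW ∘ subst (rejAssign ⊨_) (sym (⟦word⟧ w)))))
        pair , final   = to ∧≡true⇔ accepting
    in qf , wordBox⇒Run A w pair , final

theorem22 : ∀ {n t k : ℕ} (G : Grammar n t) (A : NFA k t) (σ : Fin n → Form k) →
    System.IsLeastSolution G A σ →
    (str : System.Strategy G A) → System.IsσStrategy G A σ str →
    ∀ α → System.InW G A σ α → System.Winning G A str α
theorem22 G A σ (isSolution , _) str σstr α inW w play =
  InW-word⇒InL w (play-InW str σstr play inW)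
  where open Invariant G A σ isSolution
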